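{- Let $X$ be a $(95,40,12,20)$ strongly regular graph and let $K$ be a $4$-clique of $X$ that is not contained in any $5$-clique of $X$. For $i\in\{0,1,2,3\}$ let $X_i$ be the set of vertices of $V(X)\setminus V(K)$ having exactly $i$ neighbours in $K$, and suppose $(|X_0|,|X_1|,|X_2|,|X_3|)=(2,31,57,1)$. Write $X_0=\{x_0,x_1\}$ and $X_3=\{x_3\}$, and let $X_2^0$ be the set of vertices of $X_2$ adjacent to $x_0$ but not adjacent to $x_1$. If $x_3$ is adjacent to a neighbour of $x_1$ lying in $X_1$, then $x_3$ has exactly one neighbour in $X_2^0$; otherwise $x_3$ has no neighbour in $X_2^0$.
   Context: A $k$-regular graph $G$ on $v$ vertices is a $(v,k,\lambda,\mu)$ strongly regular graph if any two distinct adjacent vertices have exactly $\lambda$ common neighbours and any two distinct non-adjacent vertices have exactly $\mu$ common neighbours. -}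

module Defs where

open import Data.Nat using (ℕ; zero; suc; _+_)
open import Data.Fin using (Fin; zero; suc)
open import Data.Bool using (Bool; true; false; if_then_else_; _∧_; not)
open import Data.Product using (Σ; _×_; ∃-syntax)
open import Relation.Binary.PropositionalEquality using (_≡_; _≢_)
open import Relation.Nullary using (¬_)

count : ∀ {n} → (Fin n → Bool) → ℕ
count {zero}  p = 0
count {suc n} p = (if p zero then 1 else 0) + count (λ i → p (suc i))

record Graph (n : ℕ) : Set where
  field
    adj   : Fin n → Fin n → Bool
    sym   : ∀ u v → adj u v ≡ adj v u
    irrefl : ∀ v → adj v v ≡ false
open Graph public

degree : ∀ {n} → Graph n → Fin n → ℕ
degree G v = count (λ w → adj G v w)

common : ∀ {n} → Graph n → Fin n → Fin n → ℕ
common G u v = count (λ w → adj G u w ∧ adj G v w)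

record IsSRG {v : ℕ} (G : Graph v) (k lam mu : ℕ) : Set where
  field
    regular  : ∀ x → degree G x ≡ k
    adjCommon    : ∀ x y → x ≢ y → adj G x y ≡ true  → common G x y ≡ lam
    nonadjCommon : ∀ x y → x ≢ y → adj G x y ≡ false → common G x y ≡ mu

Subset : ℕ → Set
Subset n = Fin n → Bool

_⊆_ : ∀ {n} → Subset n → Subset n → Set
S ⊆ T = ∀ x → S x ≡ true → T x ≡ true

IsClique : ∀ {n} → Graph n → ℕ → Subset n → Set
IsClique G m S = (count S ≡ m) ×
  (∀ x y → S x ≡ true → S y ≡ true → x ≢ y → adj G x y ≡ true)

nbrsIn : ∀ {n} → Graph n → Subset n → Fin n → ℕ
nbrsIn G S x = count (λ w → S w ∧ adj G x w)

eqℕ : ℕ → ℕ → Bool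
eqℕ zero zero = true
eqℕ zero (suc _) = false
eqℕ (suc _) zero = false
eqℕ (suc a) (suc b) = eqℕ a b

InX : ∀ {n} → Graph n → Subset n → ℕ → Fin n → Set
InX G K i x = (K x ≡ false) × (nbrsIn G K x ≡ i)

sizeX : ∀ {n} → Graph n → Subset n → ℕ → ℕ
sizeX G K i = count (λ x → not (K x) ∧ eqℕ (nbrsIn G K x) i)

-- Let A be the adjacency matrix of X. Its eigenvalues are 40, 2 and -10, and M = 10 I - 5 A + 2 J is
-- 60 times the orthogonal projection onto the (-10)-eigenspace, so M² = 60 M and M is positive
-- semidefinite: for every family of vertices the matrix of M-entries is a Gram matrix. Listing
-- K = {a, b, c, d} with a the vertex of K not adjacent to x₃, positive semidefiniteness on
-- {x₃, x₁, x₀, a, b, c, d} forces x₀ ≁ x₁ and x₀ ~ x₃ ~ x₁. For any further vertex w it leaves only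
-- few possibilities for the adjacencies of w to these seven vertices (the others are refuted by
-- explicit integer vectors), and on each of them the indicators of w ∈ X₂⁰ ∩ N(x₃) and of
-- w ∈ X₁ ∩ N(x₁) ∩ N(x₃) equal fixed integer combinations of [w ~ v], [w ~ v][w ~ v′] and [w = v],
-- v and v′ among the seven vertices. Summing over w with the parameters of X gives 1 for both: x₃ has
-- exactly one neighbour in X₂⁰, and it always has a neighbour in X₁ adjacent to x₁, so the second
-- alternative never occurs.

module Submission where

open import Defs hiding (sym)
open import Agda.Builtin.FromNat
open import Agda.Builtin.FromNeg
open import Data.Bool using (Bool; true; false; _∧_; _∨_; not; if_then_else_; T)
open import Data.Bool.Properties using (∧-identityʳ; ∧-idem; T-≡; T-∧; T-∨)
open import Data.Empty using (⊥-elim)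
open import Data.Fin using (Fin; zero; suc)
open import Data.Fin.Patterns using (0F; 1F; 2F; 3F; 4F; 5F; 6F)
open import Data.Fin.Properties using (_≟_; any?)
open import Data.Integer as ℤ using (ℤ; +_; -[1+_]; _+_; _*_; _≤_; _≤ᵇ_; 0ℤ)
import Data.Integer.Literals as ℤLit
import Data.Integer.Properties as ℤ
open import Algebra.Properties.CommutativeSemigroup ℤ.*-commutativeSemigroup
  using (interchange; x∙yz≈y∙xz)
open import Algebra.Properties.Semiring.Sum ℤ.+-*-semiring
  using (sum; sum-syntax; sum-cong-≗; sum-replicate-zero; ∑-comm; ∑-distrib-+;
         *-distribˡ-sum; *-distribʳ-sum)
open import Data.Integer.Tactic.RingSolver using (solve-∀)
open import Data.Nat as ℕ using (ℕ; zero; suc)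
import Data.Nat.Literals as ℕLit
import Data.Nat.Properties as ℕ
open import Data.Product using (Σ-syntax; ∃-syntax; _×_; _,_; proj₁; proj₂)
open import Data.Sum using ([_,_]′)
open import Data.Unit using (tt)
open import Data.Vec as Vec using (Vec; lookup; tabulate)
open import Data.Vec.Functional using (Vector; []; _∷_; foldr)
open import Data.Vec.Properties using (lookup∘tabulate)
open import Function using (_∘_; Equivalence)
open import Relation.Binary.PropositionalEquality
open import Relation.Nullary using (¬_; Dec; does; yes; no)
open import Relation.Nullary.Decidable using (⌊_⌋; dec-true; dec-false; toWitness)

instance
  ℕ-number : Number ℕ
  ℕ-number = ℕLit.number
  ℤ-number : Number ℤ
  ℤ-number = ℤLit.number
  ℤ-negative : Negative ℤ
  ℤ-negative = ℤLit.negative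

-- Counting with indicators

bit : Bool → ℕ
bit b = if b then 1 else 0

ind : Bool → ℤ
ind b = + bit b

δ : ∀ {n} → Fin n → Fin n → ℤ
δ x u = ind (does (x ≟ u))

ind-∧ : ∀ a b → ind (a ∧ b) ≡ ind a * ind b
ind-∧ true  true  = refl
ind-∧ true  false = refl
ind-∧ false b     = refl

false≢true : false ≢ true
false≢true ()

∧-≡-true : ∀ {a b} → a ∧ b ≡ true → a ≡ true × b ≡ true
∧-≡-true {true} e = refl , e

not-≡-true : ∀ {a} → not a ≡ true → a ≡ false
not-≡-true {false} _ = refl

eqℕ-sound : ∀ m n → T (eqℕ m n) → m ≡ n
eqℕ-sound zero    zero    _ = refl
eqℕ-sound (suc m) (suc n) e = cong suc (eqℕ-sound m n e)

count-as-sum : ∀ {n} (p : Subset n) → + count p ≡ sum (λ u → ind (p u))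
count-as-sum {zero}  p = refl
count-as-sum {suc n} p = cong (_+_ (ind (p zero))) (count-as-sum (p ∘ suc))

count-cong : ∀ {n} {p q : Subset n} → (∀ u → p u ≡ q u) → count p ≡ count q
count-cong {zero}  e = refl
count-cong {suc n} e = cong₂ (λ b c → bit b ℕ.+ c) (e zero) (count-cong (e ∘ suc))

count≡0 : ∀ {n} (p : Subset n) → count p ≡ 0 → ∀ u → p u ≡ false
count≡0 {suc n} p c u with p zero in p0
count≡0 {suc n} p () u       | true
count≡0 {suc n} p c zero    | false = p0
count≡0 {suc n} p c (suc u) | false = count≡0 (p ∘ suc) c u

count-split : ∀ {n} (p q : Subset n) →
  count p ≡ count (λ u → p u ∧ q u) ℕ.+ count (λ u → p u ∧ not (q u))
count-split {zero}  p q = refl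
count-split {suc n} p q with p zero | q zero | count-split (p ∘ suc) (q ∘ suc)
... | false | _     | e = e
... | true  | true  | e = cong suc e
... | true  | false | e = trans (cong suc e) (sym (ℕ.+-suc _ _))

pick : ∀ {n} (p : Subset n) {m} → count p ≡ suc m →
  Σ[ x ∈ Fin n ] p x ≡ true × count (λ u → p u ∧ not (does (x ≟ u))) ≡ m
pick {suc n} p c with p zero in p0
... | true  = zero , p0 , trans (count-cong (λ u → ∧-identityʳ (p (suc u)))) (ℕ.suc-injective c)
... | false with pick (p ∘ suc) c
...   | x , px , cx = suc x , px , cx

∑-δ : ∀ {n} (x : Fin n) (f : Vector ℤ n) → sum (λ u → δ x u * f u) ≡ f x
∑-δ {suc n} zero f = begin
  1 * f zero + ∑[ u < n ] (0ℤ * f (suc u))  ≡⟨ cong₂ _+_ (ℤ.*-identityˡ (f zero)) ∑0 ⟩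
  f zero + 0ℤ                               ≡⟨ ℤ.+-identityʳ (f zero) ⟩
  f zero                                    ∎
  where
  open ≡-Reasoning
  ∑0 : ∑[ u < n ] (0ℤ * f (suc u)) ≡ 0ℤ
  ∑0 = trans (sum-cong-≗ (λ u → ℤ.*-zeroˡ (f (suc u)))) (sum-replicate-zero n)
∑-δ {suc n} (suc x) f =
  trans (cong₂ _+_ (ℤ.*-zeroˡ (f zero)) (∑-δ x (f ∘ suc))) (ℤ.+-identityˡ (f (suc x)))

∑-δ-one : ∀ {n} (x : Fin n) → sum (δ x) ≡ 1
∑-δ-one x = trans (sum-cong-≗ (λ u → sym (ℤ.*-identityʳ (δ x u)))) (∑-δ x (λ _ → 1))

∑-nonneg : ∀ {n} (f : Vector ℤ n) → (∀ u → 0ℤ ≤ f u) → 0ℤ ≤ sum f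
∑-nonneg {zero}  f h = ℤ.≤-refl
∑-nonneg {suc n} f h = ℤ.+-mono-≤ (h zero) (∑-nonneg (f ∘ suc) (h ∘ suc))

cong₃ : ∀ {A B C D : Set} (f : A → B → C → D) {x y z a b c} →
  x ≡ a → y ≡ b → z ≡ c → f x y z ≡ f a b c
cong₃ f refl refl refl = refl

∑-lin₃ : ∀ {n} (a b c : ℤ) (f g h : Vector ℤ n) →
  sum (λ w → a * f w + b * g w + c * h w) ≡ a * sum f + b * sum g + c * sum h
∑-lin₃ {n} a b c f g h = begin
  ∑[ w < n ] (a * f w + b * g w + c * h w)
    ≡⟨ ∑-distrib-+ (λ w → a * f w + b * g w) (λ w → c * h w) ⟩
  ∑[ w < n ] (a * f w + b * g w) + ∑[ w < n ] (c * h w)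
    ≡⟨ cong₂ _+_ (∑-distrib-+ (λ w → a * f w) (λ w → b * g w)) (sym (*-distribˡ-sum c h)) ⟩
  ∑[ w < n ] (a * f w) + ∑[ w < n ] (b * g w) + c * sum h
    ≡⟨ cong₂ (λ x y → x + y + c * sum h) (sym (*-distribˡ-sum a f)) (sym (*-distribˡ-sum b g)) ⟩
  a * sum f + b * sum g + c * sum h ∎
  where open ≡-Reasoning

-- Listing the elements of a finite set

record Listing {n} (p : Subset n) (k : ℕ) : Set where
  field
    elem      : Vector (Fin n) k
    member    : ∀ i → p (elem i) ≡ true
    injective : ∀ {i j} → elem i ≡ elem j → i ≡ j
    indicator : ∀ u → ind (p u) ≡ sum (λ i → δ (elem i) u)

ind-split : ∀ {n} (p : Subset n) {x} → p x ≡ true →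
  ∀ u → ind (p u) ≡ δ x u + ind (p u ∧ not (does (x ≟ u)))
ind-split p {x} px u with x ≟ u
... | yes refl rewrite px = refl
... | no  _    = cong ind (sym (∧-identityʳ (p u)))

listing : ∀ {n} (p : Subset n) k → count p ≡ k → Listing p k
listing p zero c = record
  { elem      = []
  ; member    = λ ()
  ; injective = λ { {()} }
  ; indicator = λ u → cong ind (count≡0 p c u)
  }
listing p (suc k) c with pick p c
... | x , px , c′ = record
  { elem      = x ∷ elem
  ; member    = λ { zero → px ; (suc i) → proj₁ (∧-≡-true {p (elem i)} (member i)) }
  ; injective = λ { {zero} {zero} _ → refl
                  ; {zero} {suc j} e → ⊥-elim (fresh j e)
                  ; {suc i} {zero} e → ⊥-elim (fresh i (sym e))
                  ; {suc i} {suc j} e → cong suc (injective e) }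
  ; indicator = λ u → trans (ind-split p px u) (cong (_+_ (δ x u)) (indicator u))
  }
  where
  open Listing (listing (λ u → p u ∧ not (does (x ≟ u))) k c′)
  fresh : ∀ i → x ≢ elem i
  fresh i e = false≢true (trans (sym (not-≡-true (proj₂ (∧-≡-true {p (elem i)} (member i)))))
                               (dec-true (x ≟ elem i) e))

listing-∷ : ∀ {n k} {p q : Subset n} → Listing (λ u → p u ∧ not (q u)) 1 → Listing (λ u → p u ∧ q u) k →
  Listing p (suc k)
listing-∷ {p = p} {q} L₁ Lₖ = record
  { elem      = x ∷ Listing.elem Lₖ
  ; member    = λ { zero → proj₁ (∧-≡-true {p x} (Listing.member L₁ zero))
                  ; (suc i) → proj₁ (∧-≡-true {p (Listing.elem Lₖ i)} (Listing.member Lₖ i)) }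
  ; injective = λ { {zero} {zero} _ → refl
                  ; {zero} {suc j} e → ⊥-elim (separated j e)
                  ; {suc i} {zero} e → ⊥-elim (separated i (sym e))
                  ; {suc i} {suc j} e → cong suc (Listing.injective Lₖ e) }
  ; indicator = indicator
  }
  where
  x = Listing.elem L₁ zero
  ¬qx : q x ≡ false
  ¬qx = not-≡-true (proj₂ (∧-≡-true {p x} (Listing.member L₁ zero)))
  separated : ∀ j → x ≢ Listing.elem Lₖ j
  separated j e = false≢true (trans (sym ¬qx) (trans (cong q e)
                    (proj₂ (∧-≡-true {p (Listing.elem Lₖ j)} (Listing.member Lₖ j)))))
  split : ∀ a b → ind a ≡ ind (a ∧ not b) + ind (a ∧ b)
  split true  true  = refl
  split true  false = refl
  split false b     = refl
  indicator : ∀ u → ind (p u) ≡ δ x u + ∑[ i < _ ] δ (Listing.elem Lₖ i) u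
  indicator u = trans (split (p u) (q u))
    (cong₂ _+_ (trans (Listing.indicator L₁ u) (ℤ.+-identityʳ (δ x u))) (Listing.indicator Lₖ u))

module _ {n k} {p : Subset n} (L : Listing p k) where
  open Listing L

  count-∧-listing : ∀ q → count (λ u → p u ∧ q u) ≡ count (λ i → q (elem i))
  count-∧-listing q = ℤ.+-injective (begin
    + count (λ u → p u ∧ q u)                       ≡⟨ count-as-sum (λ u → p u ∧ q u) ⟩
    ∑[ u < n ] ind (p u ∧ q u)                      ≡⟨ sum-cong-≗ (λ u → ind-∧ (p u) (q u)) ⟩
    ∑[ u < n ] (ind (p u) * ind (q u))              ≡⟨ sum-cong-≗ (λ u → cong (_* ind (q u)) (indicator u)) ⟩
    ∑[ u < n ] (∑[ i < k ] δ (elem i) u * ind (q u))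
      ≡⟨ sum-cong-≗ (λ u → *-distribʳ-sum (ind (q u)) (λ i → δ (elem i) u)) ⟩
    ∑[ u < n ] (∑[ i < k ] (δ (elem i) u * ind (q u))) ≡⟨ ∑-comm (λ u i → δ (elem i) u * ind (q u)) ⟩
    ∑[ i < k ] (∑[ u < n ] (δ (elem i) u * ind (q u))) ≡⟨ sum-cong-≗ (λ i → ∑-δ (elem i) (ind ∘ q)) ⟩
    ∑[ i < k ] ind (q (elem i))                     ≡⟨ sym (count-as-sum (λ i → q (elem i))) ⟩
    + count (λ i → q (elem i))                      ∎)
    where open ≡-Reasoning

  unlisted : ∀ {u} → (∀ i → elem i ≢ u) → p u ≡ false
  unlisted {u} absent = ind≡0 (trans (indicator u)
    (trans (sum-cong-≗ λ i → cong ind (dec-false (elem i ≟ u) (absent i))) (sum-replicate-zero k)))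
    where ind≡0 : ∀ {b} → ind b ≡ 0ℤ → b ≡ false
          ind≡0 {false} _ = refl

  listed : ∀ {u} → p u ≡ true → Σ[ i ∈ Fin k ] elem i ≡ u
  listed {u} pu with any? (λ i → elem i ≟ u)
  ... | yes found = found
  ... | no  ¬found = ⊥-elim (false≢true (trans (sym (unlisted (λ i e → ¬found (i , e)))) pu))

count≡1-unique : ∀ {n} (p : Subset n) → count p ≡ 1 → ∀ {x y} → p x ≡ true → p y ≡ true → x ≡ y
count≡1-unique p c px py with listed (listing p 1 c) px | listed (listing p 1 c) py
... | zero , ex | zero , ey = trans (sym ex) ey

-- Gram matrices

square-nonneg : ∀ i → 0ℤ ≤ i * i
square-nonneg (+ zero)  = ℤ.+≤+ ℕ.z≤n
square-nonneg (+ suc n) = ℤ.+≤+ ℕ.z≤n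
square-nonneg -[1+ n ] = ℤ.+≤+ ℕ.z≤n

gramForm : ∀ {n k} → (Fin n → Fin n → ℤ) → Vector (Fin n) k → Vector ℤ k → ℤ
gramForm {k = k} M p α = ∑[ i < k ] (∑[ j < k ] (α i * α j * M (p i) (p j)))

-- c · Σᵢⱼ αᵢ αⱼ M(pᵢ, pⱼ) = Σ_w (Σᵢ αᵢ M(pᵢ, w))², as M² = c M.
gramForm-nonneg : ∀ {n k} (M : Fin n → Fin n → ℤ) (c : ℤ) .{{_ : ℤ.Positive c}} →
  (∀ u v → sum (λ w → M u w * M v w) ≡ c * M u v) →
  (p : Vector (Fin n) k) (α : Vector ℤ k) → 0ℤ ≤ gramForm M p α
gramForm-nonneg {n} {k} M c M²≡cM p α =
  ℤ.*-cancelˡ-≤-pos 0ℤ (gramForm M p α) c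
    (subst₂ _≤_ (sym (ℤ.*-zeroʳ c)) squares (∑-nonneg _ (λ w → square-nonneg (y w))))
  where
  open ≡-Reasoning
  a : Fin k → Fin n → ℤ
  a i w = α i * M (p i) w
  y : Vector ℤ n
  y w = ∑[ i < k ] a i w
  squares : ∑[ w < n ] (y w * y w) ≡ c * gramForm M p α
  squares = begin
    ∑[ w < n ] (y w * y w)
      ≡⟨ sum-cong-≗ (λ w → trans (*-distribʳ-sum (y w) (λ i → a i w))
                                 (sum-cong-≗ λ i → *-distribˡ-sum (a i w) (λ j → a j w))) ⟩
    ∑[ w < n ] (∑[ i < k ] (∑[ j < k ] (a i w * a j w)))
      ≡⟨ ∑-comm (λ w i → ∑[ j < k ] (a i w * a j w)) ⟩
    ∑[ i < k ] (∑[ w < n ] (∑[ j < k ] (a i w * a j w)))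
      ≡⟨ sum-cong-≗ (λ i → ∑-comm (λ w j → a i w * a j w)) ⟩
    ∑[ i < k ] (∑[ j < k ] (∑[ w < n ] (a i w * a j w)))
      ≡⟨ sum-cong-≗ (λ i → sum-cong-≗ λ j → pair i j) ⟩
    ∑[ i < k ] (∑[ j < k ] (c * (α i * α j * M (p i) (p j))))
      ≡⟨ sum-cong-≗ (λ i → sym (*-distribˡ-sum c (λ j → α i * α j * M (p i) (p j)))) ⟩
    ∑[ i < k ] (c * ∑[ j < k ] (α i * α j * M (p i) (p j)))
      ≡⟨ sym (*-distribˡ-sum c (λ i → ∑[ j < k ] (α i * α j * M (p i) (p j)))) ⟩
    c * gramForm M p α ∎
    where
    pair : ∀ i j → ∑[ w < n ] (a i w * a j w) ≡ c * (α i * α j * M (p i) (p j))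
    pair i j = begin
      ∑[ w < n ] (a i w * a j w)
        ≡⟨ sum-cong-≗ (λ w → interchange (α i) (M (p i) w) (α j) (M (p j) w)) ⟩
      ∑[ w < n ] (α i * α j * (M (p i) w * M (p j) w))
        ≡⟨ sym (*-distribˡ-sum (α i * α j) (λ w → M (p i) w * M (p j) w)) ⟩
      α i * α j * ∑[ w < n ] (M (p i) w * M (p j) w)
        ≡⟨ cong (α i * α j *_) (M²≡cM (p i) (p j)) ⟩
      α i * α j * (c * M (p i) (p j))
        ≡⟨ x∙yz≈y∙xz (α i * α j) c (M (p i) (p j)) ⟩
      c * (α i * α j * M (p i) (p j)) ∎

-- Configurations of vertices and sums over vertices

-- The entry of 10 I − 5 A + 2 J at a pair of vertices, given whether they coincide and whether they
-- are adjacent.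
gramEntry : Bool → Bool → ℤ
gramEntry true  _     = 12
gramEntry false true  = -3
gramEntry false false = 2

Pattern : ℕ → Set
Pattern k = Fin k → Fin k → Bool

extend : ∀ {k} → Pattern k → Vector Bool k → Pattern (suc k)
extend P t zero    zero    = false
extend P t zero    (suc j) = t j
extend P t (suc i) zero    = t i
extend P t (suc i) (suc j) = P i j

complete : ∀ {k} → Pattern k
complete i j = not (does (i ≟ j))

record Embeds {n k} (G : Graph n) (P : Pattern k) (p : Vector (Fin n) k) : Set where
  field
    injective : ∀ {i j} → p i ≡ p j → i ≡ j
    adjacency : ∀ i j → adj G (p i) (p j) ≡ P i j

embeds-∷ : ∀ {n k} {G : Graph n} {P : Pattern k} {p w t} → Embeds G P p →
  (∀ j → w ≢ p j) → (∀ j → adj G w (p j) ≡ t j) → Embeds G (extend P t) (w ∷ p)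
embeds-∷ {G = G} {p = p} {w} {t} e fresh row = record
  { injective = λ { {zero} {zero} _ → refl
                  ; {zero} {suc j} w≡pj → ⊥-elim (fresh j w≡pj)
                  ; {suc i} {zero} pi≡w → ⊥-elim (fresh i (sym pi≡w))
                  ; {suc i} {suc j} pi≡pj → cong suc (injective pi≡pj) }
  ; adjacency = λ { zero zero → irrefl G w
                  ; zero (suc j) → row j
                  ; (suc i) zero → trans (Graph.sym G (p i) w) (row i)
                  ; (suc i) (suc j) → adjacency i j }
  }
  where open Embeds e

embeds-clique : ∀ {n k} {G : Graph n} {K : Subset n} →
  (∀ x y → K x ≡ true → K y ≡ true → x ≢ y → adj G x y ≡ true) →
  (L : Listing K k) → Embeds G complete (Listing.elem L)
embeds-clique {G = G} clique L = record { injective = injective ; adjacency = adjacency }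
  where
  open Listing L
  adjacency : ∀ i j → adj G (elem i) (elem j) ≡ complete i j
  adjacency i j with i ≟ j
  ... | yes refl = irrefl G (elem i)
  ... | no i≢j   = clique (elem i) (elem j) (member i) (member j) (i≢j ∘ injective)

≟-injective : ∀ {n k} {p : Vector (Fin n) k} → (∀ {i j} → p i ≡ p j → i ≡ j) →
  ∀ i j → does (p i ≟ p j) ≡ does (i ≟ j)
≟-injective {p = p} injective i j with i ≟ j
... | yes refl = dec-true (p i ≟ p i) refl
... | no i≢j   = dec-false (p i ≟ p j) (i≢j ∘ injective)

gram : ∀ {k} → Pattern k → Vector ℤ k → ℤ
gram P = gramForm (λ i j → gramEntry (does (i ≟ j)) (P i j)) (λ i → i)

refutes : ∀ {k m} → Vector (Vector ℤ k) m → Pattern k → Bool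
refutes αs P = foldr (λ α b → not (0ℤ ≤ᵇ gram P α) ∨ b) false αs

refutes-sound : ∀ {k m} (αs : Vector (Vector ℤ k) m) (P : Pattern k) →
  (∀ α → 0ℤ ≤ gram P α) → ¬ T (refutes αs P)
refutes-sound {m = suc m} αs P psd r with 0ℤ ≤ᵇ gram P (αs zero) in e
... | true  = refutes-sound (αs ∘ suc) P psd r
... | false = subst T e (ℤ.≤⇒≤ᵇ (psd (αs zero)))

-- For a configuration p and a vertex w, nbr j, nbr² j l and is j stand for [w ~ p j],
-- [w ~ p j][w ~ p l] and [w = p j].
data Monomial (k : ℕ) : Set where
  nbr  : Fin k → Monomial k
  nbr² : Fin k → Fin k → Monomial k
  is   : Fin k → Monomial k

Poly : ℕ → ℕ → Set
Poly k m = Vector (ℤ × Monomial k) m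

⟦_⟧ₘ : ∀ {k} → Monomial k → Vector Bool k → Vector Bool k → ℤ
⟦ nbr j ⟧ₘ    r e = ind (r j)
⟦ nbr² j l ⟧ₘ r e = ind (r j) * ind (r l)
⟦ is j ⟧ₘ     r e = ind (e j)

⟦_⟧ : ∀ {k m} → Poly k m → Vector Bool k → Vector Bool k → ℤ
⟦_⟧ {m = m} π r e = ∑[ s < m ] (proj₁ (π s) * ⟦ proj₂ (π s) ⟧ₘ r e)

⟦⟧-cong : ∀ {k m} (π : Poly k m) {r r′ e e′} → (∀ j → r j ≡ r′ j) → (∀ j → e j ≡ e′ j) →
  ⟦ π ⟧ r e ≡ ⟦ π ⟧ r′ e′
⟦⟧-cong π {r} {r′} {e} {e′} r≗r′ e≗e′ =
  sum-cong-≗ λ s → cong (proj₁ (π s) *_) (monomial (proj₂ (π s)))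
  where
  monomial : ∀ m → ⟦ m ⟧ₘ r e ≡ ⟦ m ⟧ₘ r′ e′
  monomial (nbr j)    = cong ind (r≗r′ j)
  monomial (nbr² j l) = cong₂ (λ x y → ind x * ind y) (r≗r′ j) (r≗r′ l)
  monomial (is j)     = cong ind (e≗e′ j)

_⟨_⟩_ : ∀ {n k m} → Graph n → Vector (Fin n) k → Poly k m → Fin n → ℤ
(G ⟨ p ⟩ π) w = ⟦ π ⟧ (λ j → adj G (p j) w) (λ j → does (p j ≟ w))

total : ∀ {k} (deg lam mu : ℕ) → Pattern k → Monomial k → ℤ
total deg lam mu P (nbr j)    = + deg
total deg lam mu P (nbr² j l) = + (if does (j ≟ l) then deg else if P j l then lam else mu)
total deg lam mu P (is j)     = 1

module SRG {n} {G : Graph n} {deg lam mu} (srg : IsSRG G deg lam mu) where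
  open IsSRG srg

  ∑-adj : ∀ u → sum (λ w → ind (adj G u w)) ≡ + deg
  ∑-adj u = trans (sym (count-as-sum (adj G u))) (cong +_ (regular u))

  ∑-common : ∀ u v → sum (λ w → ind (adj G u w) * ind (adj G v w)) ≡ + common G u v
  ∑-common u v = trans (sum-cong-≗ λ w → sym (ind-∧ (adj G u w) (adj G v w)))
                       (sym (count-as-sum (λ w → adj G u w ∧ adj G v w)))

  common-self : ∀ u → common G u u ≡ deg
  common-self u = trans (count-cong (λ w → ∧-idem (adj G u w))) (regular u)

  module _ {k} {P : Pattern k} {p} (e : Embeds G P p) where
    open Embeds e

    ∑-monomial : ∀ m →
      sum (λ w → ⟦ m ⟧ₘ (λ j → adj G (p j) w) (λ j → does (p j ≟ w))) ≡ total deg lam mu P m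
    ∑-monomial (nbr j)    = ∑-adj (p j)
    ∑-monomial (nbr² j l) = trans (∑-common (p j) (p l)) (cong +_ (common-pattern j l))
      where
      common-pattern : ∀ j l →
        common G (p j) (p l) ≡ (if does (j ≟ l) then deg else if P j l then lam else mu)
      common-pattern j l with j ≟ l
      ... | yes refl = common-self (p j)
      ... | no j≢l with P j l in a
      ...   | true  = adjCommon    (p j) (p l) (j≢l ∘ injective) (trans (adjacency j l) a)
      ...   | false = nonadjCommon (p j) (p l) (j≢l ∘ injective) (trans (adjacency j l) a)
    ∑-monomial (is j)     = ∑-δ-one (p j)

    ∑-poly : ∀ {m} (π : Poly k m) →
      sum (G ⟨ p ⟩ π) ≡ sum (λ s → proj₁ (π s) * total deg lam mu P (proj₂ (π s)))
    ∑-poly {m} π = begin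
      ∑[ w < n ] (∑[ s < m ] (proj₁ (π s) * ⟦ proj₂ (π s) ⟧ₘ (row w) (eq w)))
        ≡⟨ ∑-comm (λ w s → proj₁ (π s) * ⟦ proj₂ (π s) ⟧ₘ (row w) (eq w)) ⟩
      ∑[ s < m ] (∑[ w < n ] (proj₁ (π s) * ⟦ proj₂ (π s) ⟧ₘ (row w) (eq w)))
        ≡⟨ sum-cong-≗ (λ s → trans (sym (*-distribˡ-sum (proj₁ (π s)) (λ w → ⟦ proj₂ (π s) ⟧ₘ (row w) (eq w))))
                                   (cong (proj₁ (π s) *_) (∑-monomial (proj₂ (π s))))) ⟩
      ∑[ s < m ] (proj₁ (π s) * total deg lam mu P (proj₂ (π s))) ∎
      where
      open ≡-Reasoning
      row eq : Fin n → Vector Bool k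
      row w j = adj G (p j) w
      eq  w j = does (p j ≟ w)

-- The (95, 40, 12, 20) graph

M²-entry : ∀ e a (c : ℕ) →
  (e ≡ true → a ≡ false × c ≡ 40) → (e ≡ false → a ≡ true → c ≡ 12) → (e ≡ false → a ≡ false → c ≡ 20) →
  10 * gramEntry e a + -5 * (10 * ind a + -5 * + c + 2 * 40) + 2 * 0 ≡ 60 * gramEntry e a
M²-entry true  a     c same _ _ with same refl
... | refl , refl = refl
M²-entry false true  c _ adjacent _ rewrite adjacent refl refl = refl
M²-entry false false c _ _ nonadjacent rewrite nonadjacent refl refl = refl

module SRG-95-40-12-20 {G : Graph 95} (srg : IsSRG G 40 12 20) where
  open IsSRG srg
  open SRG srg

  M : Fin 95 → Fin 95 → ℤ
  M u v = gramEntry (does (u ≟ v)) (adj G u v)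

  A : Fin 95 → Fin 95 → ℤ
  A u v = ind (adj G u v)

  M-expand : ∀ u w → M u w ≡ 10 * δ u w + -5 * A u w + 2 * 1
  M-expand u w with u ≟ w
  ... | yes refl rewrite irrefl G u = refl
  ... | no _ with adj G u w
  ...   | true  = refl
  ...   | false = refl

  M-sym : ∀ u v → M u v ≡ M v u
  M-sym u v = cong₂ gramEntry (≟-sym u v) (Graph.sym G u v)
    where
    ≟-sym : ∀ u v → does (u ≟ v) ≡ does (v ≟ u)
    ≟-sym u v with u ≟ v | v ≟ u
    ... | yes _ | yes _ = refl
    ... | no  _ | no  _ = refl
    ... | yes e | no ¬e = ⊥-elim (¬e (sym e))
    ... | no ¬e | yes e = ⊥-elim (¬e (sym e))

  ∑-M : ∀ v → sum (M v) ≡ 0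
  ∑-M v = begin
    sum (M v)                                       ≡⟨ sum-cong-≗ (M-expand v) ⟩
    sum (λ w → 10 * δ v w + -5 * A v w + 2 * 1)     ≡⟨ ∑-lin₃ 10 -5 2 (δ v) (A v) (λ _ → 1) ⟩
    10 * sum (δ v) + -5 * sum (A v) + 2 * sum {95} (λ _ → 1)
      ≡⟨ cong₂ (λ x y → 10 * x + -5 * y + 2 * sum {95} (λ _ → 1)) (∑-δ-one v) (∑-adj v) ⟩
    0                                               ∎
    where open ≡-Reasoning

  ∑-AM : ∀ u v → sum (λ w → A u w * M v w) ≡ 10 * A u v + -5 * + common G u v + 2 * 40
  ∑-AM u v = begin
    sum (λ w → A u w * M v w)
      ≡⟨ sum-cong-≗ (λ w → trans (cong (A u w *_) (M-expand v w)) (expand (A u w) (δ v w) (A v w))) ⟩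
    sum (λ w → 10 * (δ v w * A u w) + -5 * (A u w * A v w) + 2 * A u w)
      ≡⟨ ∑-lin₃ 10 -5 2 (λ w → δ v w * A u w) (λ w → A u w * A v w) (A u) ⟩
    10 * sum (λ w → δ v w * A u w) + -5 * sum (λ w → A u w * A v w) + 2 * sum (A u)
      ≡⟨ cong₃ (λ x y z → 10 * x + -5 * y + 2 * z) (∑-δ v (A u)) (∑-common u v) (∑-adj u) ⟩
    10 * A u v + -5 * + common G u v + 2 * 40 ∎
    where
    open ≡-Reasoning
    expand : ∀ x y z → x * (10 * y + -5 * z + 2 * 1) ≡ 10 * (y * x) + -5 * (x * z) + 2 * x
    expand = solve-∀

  M² : ∀ u v → sum (λ w → M u w * M v w) ≡ 60 * M u v
  M² u v = begin
    sum (λ w → M u w * M v w)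
      ≡⟨ sum-cong-≗ (λ w → trans (cong (_* M v w) (M-expand u w)) (expand (δ u w) (A u w) (M v w))) ⟩
    sum (λ w → 10 * (δ u w * M v w) + -5 * (A u w * M v w) + 2 * M v w)
      ≡⟨ ∑-lin₃ 10 -5 2 (λ w → δ u w * M v w) (λ w → A u w * M v w) (M v) ⟩
    10 * sum (λ w → δ u w * M v w) + -5 * sum (λ w → A u w * M v w) + 2 * sum (M v)
      ≡⟨ cong₃ (λ x y z → 10 * x + -5 * y + 2 * z) (trans (∑-δ u (M v)) (M-sym v u)) (∑-AM u v) (∑-M v) ⟩
    10 * M u v + -5 * (10 * A u v + -5 * + common G u v + 2 * 40) + 2 * 0
      ≡⟨ values ⟩
    60 * M u v ∎
    where
    open ≡-Reasoning
    expand : ∀ x y z → (10 * x + -5 * y + 2 * 1) * z ≡ 10 * (x * z) + -5 * (y * z) + 2 * z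
    expand = solve-∀
    values : 10 * M u v + -5 * (10 * A u v + -5 * + common G u v + 2 * 40) + 2 * 0 ≡ 60 * M u v
    values = M²-entry (does (u ≟ v)) (adj G u v) (common G u v) same adjacent nonadjacent
      where
      same : does (u ≟ v) ≡ true → adj G u v ≡ false × common G u v ≡ 40
      same e with u ≟ v
      ... | yes refl = irrefl G u , common-self u
      adjacent : does (u ≟ v) ≡ false → adj G u v ≡ true → common G u v ≡ 12
      adjacent e a with u ≟ v
      ... | no u≢v = adjCommon u v u≢v a
      nonadjacent : does (u ≟ v) ≡ false → adj G u v ≡ false → common G u v ≡ 20
      nonadjacent e a with u ≟ v
      ... | no u≢v = nonadjCommon u v u≢v a

  gram-nonneg : ∀ {k} {P : Pattern k} {p} → Embeds G P p → ∀ α → 0ℤ ≤ gram P α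
  gram-nonneg {k} {P} {p} e α =
    subst (0ℤ ≤_) (sum-cong-≗ λ i → sum-cong-≗ λ j → cong (α i * α j *_) (entry i j))
                  (gramForm-nonneg M 60 M² p α)
    where
    open Embeds e
    entry : ∀ i j → M (p i) (p j) ≡ gramEntry (does (i ≟ j)) (P i j)
    entry i j = cong₂ gramEntry (≟-injective injective i j) (adjacency i j)

-- The finite verifications

all-rows : ∀ {n} → (Vec Bool n → Bool) → Bool
all-rows {zero}  f = f Vec.[]
all-rows {suc n} f = all-rows (f ∘ (true Vec.∷_)) ∧ all-rows (f ∘ (false Vec.∷_))

all-rows-sound : ∀ {n} (f : Vec Bool n → Bool) → T (all-rows f) → ∀ t → T (f t)
all-rows-sound f h Vec.[]            = h
all-rows-sound f h (true  Vec.∷ t) = all-rows-sound (f ∘ (true Vec.∷_)) (proj₁ (Equivalence.to T-∧ h)) t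
all-rows-sound f h (false Vec.∷ t) = all-rows-sound (f ∘ (false Vec.∷_)) (proj₂ (Equivalence.to T-∧ h)) t

-- Configurations are listed as x₃, x₁, x₀, a, b, c, d, where K = {a, b, c, d} and a is the vertex of
-- K not adjacent to x₃; the arguments of P₇ are the adjacencies x₁x₀, x₃x₁ and x₃x₀.
P₇ : Bool → Bool → Bool → Pattern 7
P₇ e₁₀ e₃₁ e₃₀ =
  extend (extend (extend complete (λ _ → false)) (e₁₀ ∷ λ _ → false)) (e₃₁ ∷ e₃₀ ∷ false ∷ λ _ → true)

-- Integer vectors on which the Gram form of each excluded adjacency pattern is negative, found from
-- LDLᵀ decompositions; certificates₈ plays the same role for the rows in check₈.
certificates₇ : Vector (Vector ℤ 7) 4
certificates₇ = (3 ∷ -6 ∷ -6 ∷ 9 ∷ 10 ∷ 10 ∷ 10 ∷ [])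
              ∷ (6 ∷ -6 ∷ -9 ∷ 12 ∷ 14 ∷ 14 ∷ 14 ∷ [])
              ∷ (6 ∷ -9 ∷ -6 ∷ 12 ∷ 14 ∷ 14 ∷ 14 ∷ [])
              ∷ (0 ∷ 4 ∷ 5 ∷ -6 ∷ -6 ∷ -6 ∷ -6 ∷ [])
              ∷ []

check₇ : Vec Bool 3 → Bool
check₇ (e₁₀ Vec.∷ e₃₁ Vec.∷ e₃₀ Vec.∷ Vec.[]) =
  (not e₁₀ ∧ (e₃₁ ∧ e₃₀)) ∨ refutes certificates₇ (P₇ e₁₀ e₃₁ e₃₀)

check₇-holds : T (all-rows check₇)
check₇-holds = _

check₇-sound : ∀ a b c → (∀ α → 0ℤ ≤ gram (P₇ a b c) α) → a ≡ false × b ≡ true × c ≡ true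
check₇-sound a b c psd =
  [ decode a b c , (λ r → ⊥-elim (refutes-sound certificates₇ (P₇ a b c) psd r)) ]′
    (Equivalence.to (T-∨ {not a ∧ (b ∧ c)} {refutes certificates₇ (P₇ a b c)})
      (all-rows-sound check₇ check₇-holds (a Vec.∷ b Vec.∷ c Vec.∷ Vec.[])))
  where
  decode : ∀ a b c → T (not a ∧ (b ∧ c)) → a ≡ false × b ≡ true × c ≡ true
  decode false true true _ = refl , refl , refl

P₇′ : Pattern 7
P₇′ = P₇ false true true

K-nbrs : Vector Bool 7 → ℕ
K-nbrs r = count (λ i → r (suc (suc (suc i))))

-- A membership test in terms of K-membership, the number of neighbours in K and the row of adjacencies.
RowTest : Set
RowTest = Bool → ℕ → Vector Bool 7 → Bool

X₂⁰∩N₃-row X₁∩N₁₃-row : RowTest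
X₂⁰∩N₃-row k n r = (not k ∧ (eqℕ n 2 ∧ (r 2F ∧ not (r 1F)))) ∧ r 0F
X₁∩N₁₃-row k n r = (not k ∧ eqℕ n 1) ∧ (r 1F ∧ r 0F)

-- The combinations of monomials solving the linear system that expresses the membership tests on the
-- rows not refuted in check₈.
X₂⁰∩N₃-poly : Poly 7 17
X₂⁰∩N₃-poly = (2 , nbr 1F) ∷ (-1 , nbr 0F) ∷ (-1 , nbr² 1F 0F)
   ∷ (-1 , nbr² 3F 1F) ∷ (-1 , nbr² 4F 1F) ∷ (-1 , nbr² 5F 1F) ∷ (-1 , nbr² 6F 1F)
   ∷ (1 , nbr² 3F 0F) ∷ (1 , nbr² 4F 0F) ∷ (1 , nbr² 5F 0F) ∷ (1 , nbr² 6F 0F)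
   ∷ (-2 , is 4F) ∷ (-2 , is 5F) ∷ (-2 , is 6F) ∷ (1 , is 2F) ∷ (1 , is 1F) ∷ (1 , is 0F) ∷ []

X₁∩N₁₃-poly : Poly 7 6
X₁∩N₁₃-poly = (2 , nbr 1F) ∷ (-1 , nbr² 3F 1F) ∷ (-1 , nbr² 4F 1F) ∷ (-1 , nbr² 5F 1F) ∷ (-1 , nbr² 6F 1F)
   ∷ (1 , is 0F) ∷ []

certificates₈ : Vector (Vector ℤ 8) 5
certificates₈ = (55 ∷ 81 ∷ -81 ∷ -82 ∷ 162 ∷ 171 ∷ 180 ∷ 189 ∷ [])
              ∷ (48 ∷ -43 ∷ 57 ∷ 54 ∷ -108 ∷ -111 ∷ -121 ∷ -121 ∷ [])
              ∷ (216 ∷ -252 ∷ 288 ∷ 289 ∷ -539 ∷ -625 ∷ -625 ∷ -552 ∷ [])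
              ∷ (108 ∷ -126 ∷ 117 ∷ 171 ∷ -270 ∷ -288 ∷ -300 ∷ -312 ∷ [])
              ∷ (36 ∷ -42 ∷ 57 ∷ 39 ∷ -90 ∷ -104 ∷ -92 ∷ -104 ∷ [])
              ∷ []

Agrees : ∀ {m} → RowTest → Poly 7 m → Vector Bool 7 → Set
Agrees φ ψ r = ind (φ false (K-nbrs r) r) ≡ ⟦ ψ ⟧ r (λ _ → false)

agrees? : ∀ {m} φ (ψ : Poly 7 m) r → Dec (Agrees φ ψ r)
agrees? φ ψ r = ind (φ false (K-nbrs r) r) ℤ.≟ ⟦ ψ ⟧ r (λ _ → false)

RowIdentities : Vector Bool 7 → Set
RowIdentities r = Agrees X₂⁰∩N₃-row X₂⁰∩N₃-poly r × Agrees X₁∩N₁₃-row X₁∩N₁₃-poly r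

row-identities? : Vector Bool 7 → Bool
row-identities? r = ⌊ agrees? X₂⁰∩N₃-row X₂⁰∩N₃-poly r ⌋ ∧ ⌊ agrees? X₁∩N₁₃-row X₁∩N₁₃-poly r ⌋

row-identities-sound : ∀ r → T (row-identities? r) → RowIdentities r
row-identities-sound r h =
  toWitness {a? = agrees? X₂⁰∩N₃-row X₂⁰∩N₃-poly r} (proj₁ both) ,
  toWitness {a? = agrees? X₁∩N₁₃-row X₁∩N₁₃-poly r} (proj₂ both)
  where
  both = Equivalence.to (T-∧ {⌊ agrees? X₂⁰∩N₃-row X₂⁰∩N₃-poly r ⌋} {⌊ agrees? X₁∩N₁₃-row X₁∩N₁₃-poly r ⌋})
                        h

-- The rows on which the membership tests and the polynomials differ have three neighbours in K; they
-- are excluded by |X₃| = 1.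
check₈ : Vec Bool 7 → Bool
check₈ t = refutes certificates₈ (extend P₇′ r) ∨ (eqℕ (K-nbrs r) 3 ∨ row-identities? r)
  where r = lookup t

check₈-holds : T (all-rows check₈)
check₈-holds = _

check₈-sound : ∀ t → (∀ α → 0ℤ ≤ gram (extend P₇′ (lookup t)) α) → K-nbrs (lookup t) ≢ 3 →
  RowIdentities (lookup t)
check₈-sound t psd ≢3 =
  [ (λ r → ⊥-elim (refutes-sound certificates₈ (extend P₇′ (lookup t)) psd r))
  , (λ h → [ (λ three → ⊥-elim (≢3 (eqℕ-sound _ 3 three))) , row-identities-sound (lookup t) ]′
             (Equivalence.to (T-∨ {eqℕ (K-nbrs (lookup t)) 3} {row-identities? (lookup t)}) h))
  ]′ (Equivalence.to (T-∨ {refutes certificates₈ (extend P₇′ (lookup t))}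
                          {eqℕ (K-nbrs (lookup t)) 3 ∨ row-identities? (lookup t)})
                     (all-rows-sound check₈ check₈-holds t))

polys-vanish : ∀ i → let r = λ j → P₇′ j i ; e = λ j → does (j ≟ i) in
  ⟦ X₂⁰∩N₃-poly ⟧ r e ≡ 0 × ⟦ X₁∩N₁₃-poly ⟧ r e ≡ 0
polys-vanish 0F = refl , refl
polys-vanish 1F = refl , refl
polys-vanish 2F = refl , refl
polys-vanish 3F = refl , refl
polys-vanish 4F = refl , refl
polys-vanish 5F = refl , refl
polys-vanish 6F = refl , refl

module Configuration
  {G : Graph 95} (srg : IsSRG G 40 12 20) {K : Subset 95} (K-clique : IsClique G 4 K)
  {x₀ x₁ x₃ : Fin 95} (x₀≢x₁ : x₀ ≢ x₁) (x₀∈X₀ : InX G K 0 x₀) (x₁∈X₀ : InX G K 0 x₁)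
  (x₃∈X₃ : InX G K 3 x₃) (|X₃|≡1 : sizeX G K 3 ≡ 1)
  where
  open SRG-95-40-12-20 srg
  open SRG srg using (∑-poly)

  -- Opaque: normalising the listings of K, as with-abstraction does, takes forever.
  opaque
    L₁ : Listing (λ u → K u ∧ not (adj G x₃ u)) 1
    L₁ = listing (λ u → K u ∧ not (adj G x₃ u)) 1 (ℕ.+-cancelˡ-≡ 3 _ _ (begin
      3 ℕ.+ c             ≡⟨ cong (ℕ._+ c) (proj₂ x₃∈X₃) ⟨
      nbrsIn G K x₃ ℕ.+ c ≡⟨ count-split K (adj G x₃) ⟨
      count K             ≡⟨ proj₁ K-clique ⟩
      4                   ∎))
      where
      open ≡-Reasoning
      c : ℕ
      c = count (λ u → K u ∧ not (adj G x₃ u))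

    L₃ : Listing (λ u → K u ∧ adj G x₃ u) 3
    L₃ = listing (λ u → K u ∧ adj G x₃ u) 3 (proj₂ x₃∈X₃)

    κ : Listing K 4
    κ = listing-∷ {p = K} {q = adj G x₃} L₁ L₃

    x₃-row : ∀ i → adj G x₃ (Listing.elem κ i) ≡ (false ∷ λ _ → true) i
    x₃-row zero    = not-≡-true (proj₂ (∧-≡-true {K (Listing.elem L₁ zero)} (Listing.member L₁ zero)))
    x₃-row (suc i) = proj₂ (∧-≡-true {K (Listing.elem L₃ i)} (Listing.member L₃ i))

  open Listing κ using (elem; member)

  X₀-row : ∀ {x} → InX G K 0 x → ∀ i → adj G x (elem i) ≡ false
  X₀-row {x} (_ , none) i =
    subst (λ b → b ∧ adj G x (elem i) ≡ false) (member i) (count≡0 (λ w → K w ∧ adj G x w) none (elem i))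

  outside-K : ∀ {x} → K x ≡ false → ∀ i → x ≢ elem i
  outside-K Kx i x≡κi = false≢true (trans (sym Kx) (trans (cong K x≡κi) (member i)))

  x₃≢ : ∀ {x} → InX G K 0 x → x₃ ≢ x
  x₃≢ {x} (_ , none) x₃≡x = ℕ.1+n≢0 (begin
    3             ≡⟨ proj₂ x₃∈X₃ ⟨
    nbrsIn G K x₃ ≡⟨ cong (nbrsIn G K) x₃≡x ⟩
    nbrsIn G K x  ≡⟨ none ⟩
    0             ∎)
    where open ≡-Reasoning

  p₇ : Vector (Fin 95) 7
  p₇ = x₃ ∷ x₁ ∷ x₀ ∷ elem

  embeds₇ : Embeds G (P₇ (adj G x₁ x₀) (adj G x₃ x₁) (adj G x₃ x₀)) p₇
  embeds₇ =
    embeds-∷ (embeds-∷ (embeds-∷ (embeds-clique (proj₂ K-clique) κ) (outside-K (proj₁ x₀∈X₀))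
                                 (X₀-row x₀∈X₀))
                       fresh₁ row₁)
             fresh₃ row₃
    where
    fresh₁ : ∀ j → x₁ ≢ (x₀ ∷ elem) j
    fresh₁ zero    = x₀≢x₁ ∘ sym
    fresh₁ (suc i) = outside-K (proj₁ x₁∈X₀) i
    row₁ : ∀ j → adj G x₁ ((x₀ ∷ elem) j) ≡ (adj G x₁ x₀ ∷ λ _ → false) j
    row₁ zero    = refl
    row₁ (suc i) = X₀-row x₁∈X₀ i
    fresh₃ : ∀ j → x₃ ≢ (x₁ ∷ x₀ ∷ elem) j
    fresh₃ zero          = x₃≢ x₁∈X₀
    fresh₃ (suc zero)    = x₃≢ x₀∈X₀
    fresh₃ (suc (suc i)) = outside-K (proj₁ x₃∈X₃) i
    row₃ : ∀ j → adj G x₃ ((x₁ ∷ x₀ ∷ elem) j) ≡ (adj G x₃ x₁ ∷ adj G x₃ x₀ ∷ false ∷ λ _ → true) j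
    row₃ zero          = refl
    row₃ (suc zero)    = refl
    row₃ (suc (suc i)) = x₃-row i

  forced : adj G x₁ x₀ ≡ false × adj G x₃ x₁ ≡ true × adj G x₃ x₀ ≡ true
  forced = check₇-sound _ _ _ (gram-nonneg embeds₇)

  embeds₇′ : Embeds G P₇′ p₇
  embeds₇′ = subst (λ P → Embeds G P p₇) (cong₃ P₇ x₁≁x₀ x₃~x₁ x₃~x₀) embeds₇
    where x₁≁x₀ = proj₁ forced ; x₃~x₁ = proj₁ (proj₂ forced) ; x₃~x₀ = proj₂ (proj₂ forced)

  X₂⁰ : Subset 95
  X₂⁰ v = not (K v) ∧ (eqℕ (nbrsIn G K v) 2 ∧ (adj G x₀ v ∧ not (adj G x₁ v)))

  X₂⁰∩N₃ X₁∩N₁₃ : Subset 95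
  X₂⁰∩N₃ w = X₂⁰ w ∧ adj G x₃ w
  X₁∩N₁₃ w = (not (K w) ∧ eqℕ (nbrsIn G K w) 1) ∧ (adj G x₁ w ∧ adj G x₃ w)

  row : Fin 95 → Vector Bool 7
  row w j = adj G (p₇ j) w

  X₃ : Subset 95
  X₃ x = not (K x) ∧ eqℕ (nbrsIn G K x) 3

  Identities : Fin 95 → Set
  Identities w =
    ind (X₂⁰∩N₃ w) ≡ (G ⟨ p₇ ⟩ X₂⁰∩N₃-poly) w × ind (X₁∩N₁₃ w) ≡ (G ⟨ p₇ ⟩ X₁∩N₁₃-poly) w

  off-configuration : ∀ w → (∀ j → w ≢ p₇ j) → Identities w
  off-configuration w fresh =
    trans (φ-eq X₂⁰∩N₃-row) (trans (proj₁ identities) (ψ-eq X₂⁰∩N₃-poly)) ,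
    trans (φ-eq X₁∩N₁₃-row) (trans (proj₂ identities) (ψ-eq X₁∩N₁₃-poly))
    where
    embeds₈ : Embeds G (extend P₇′ (lookup (tabulate (row w)))) (w ∷ p₇)
    embeds₈ = embeds-∷ embeds₇′ fresh
                (λ j → trans (Graph.sym G w (p₇ j)) (sym (lookup∘tabulate (row w) j)))
    Kw : K w ≡ false
    Kw = unlisted κ (λ i e → fresh (suc (suc (suc i))) (sym e))
    level : nbrsIn G K w ≡ K-nbrs (row w)
    level = trans (count-∧-listing κ (adj G w)) (count-cong (λ i → Graph.sym G w (elem i)))
    not-X₃ : nbrsIn G K w ≢ 3
    not-X₃ e = fresh zero (count≡1-unique X₃ |X₃|≡1 w∈X₃ x₃∈X₃′)
      where
      w∈X₃ : X₃ w ≡ true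
      w∈X₃ = cong₂ (λ k n → not k ∧ eqℕ n 3) Kw e
      x₃∈X₃′ : X₃ x₃ ≡ true
      x₃∈X₃′ = cong₂ (λ k n → not k ∧ eqℕ n 3) (proj₁ x₃∈X₃) (proj₂ x₃∈X₃)
    identities = check₈-sound (tabulate (row w)) (gram-nonneg embeds₈) (λ e → not-X₃ (trans level e))
    φ-eq : (φ : RowTest) →
      ind (φ (K w) (nbrsIn G K w) (row w)) ≡ ind (φ false (K-nbrs (row w)) (row w))
    φ-eq φ = cong₂ (λ k n → ind (φ k n (row w))) Kw level
    ψ-eq : ∀ {m} (ψ : Poly 7 m) → ⟦ ψ ⟧ (lookup (tabulate (row w))) (λ _ → false) ≡ (G ⟨ p₇ ⟩ ψ) w
    ψ-eq ψ = ⟦⟧-cong ψ (lookup∘tabulate (row w)) (λ j → sym (dec-false (p₇ j ≟ w) (fresh j ∘ sym)))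

  on-configuration : ∀ i → Identities (p₇ i)
  on-configuration i =
    trans (cong ind (proj₁ (φ-vanishes i))) (sym (trans (ψ-eq X₂⁰∩N₃-poly) (proj₁ (polys-vanish i)))) ,
    trans (cong ind (proj₂ (φ-vanishes i))) (sym (trans (ψ-eq X₁∩N₁₃-poly) (proj₂ (polys-vanish i))))
    where
    outside : ∀ {x l} → InX G K l x → (φ : RowTest) → φ (K x) (nbrsIn G K x) (row x) ≡ φ false l (row x)
    outside {x} (Kx , nx) φ = cong₂ (λ k n → φ k n (row x)) Kx nx
    inside : ∀ {x} → K x ≡ true → (φ : RowTest) →
      φ (K x) (nbrsIn G K x) (row x) ≡ φ true (nbrsIn G K x) (row x)
    inside {x} Kx φ = cong (λ k → φ k (nbrsIn G K x) (row x)) Kx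
    φ-vanishes : ∀ i → X₂⁰∩N₃ (p₇ i) ≡ false × X₁∩N₁₃ (p₇ i) ≡ false
    φ-vanishes 0F = outside x₃∈X₃ X₂⁰∩N₃-row , outside x₃∈X₃ X₁∩N₁₃-row
    φ-vanishes 1F = outside x₁∈X₀ X₂⁰∩N₃-row , outside x₁∈X₀ X₁∩N₁₃-row
    φ-vanishes 2F = outside x₀∈X₀ X₂⁰∩N₃-row , outside x₀∈X₀ X₁∩N₁₃-row
    φ-vanishes (suc (suc (suc j))) = inside (member j) X₂⁰∩N₃-row , inside (member j) X₁∩N₁₃-row
    ψ-eq : ∀ {m} (ψ : Poly 7 m) → (G ⟨ p₇ ⟩ ψ) (p₇ i) ≡ ⟦ ψ ⟧ (λ j → P₇′ j i) (λ j → does (j ≟ i))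
    ψ-eq ψ = ⟦⟧-cong ψ (λ j → adjacency j i) (λ j → ≟-injective injective j i)
      where open Embeds embeds₇′

  vertex-identity : ∀ w → Identities w
  vertex-identity w = by-cases (any? (λ i → p₇ i ≟ w))
    where
    by-cases : Dec (∃[ i ] p₇ i ≡ w) → Identities w
    by-cases (yes (i , p₇i≡w)) = subst Identities p₇i≡w (on-configuration i)
    by-cases (no absent)       = off-configuration w (λ j w≡p₇j → absent (j , sym w≡p₇j))

  count-by-poly : ∀ {m} (S : Subset 95) (ψ : Poly 7 m) → (∀ w → ind (S w) ≡ (G ⟨ p₇ ⟩ ψ) w) →
    sum (λ s → proj₁ (ψ s) * total 40 12 20 P₇′ (proj₂ (ψ s))) ≡ 1 → count S ≡ 1
  count-by-poly S ψ pointwise total≡1 = ℤ.+-injective (begin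
    + count S            ≡⟨ count-as-sum S ⟩
    sum (ind ∘ S)        ≡⟨ sum-cong-≗ pointwise ⟩
    sum (G ⟨ p₇ ⟩ ψ)     ≡⟨ ∑-poly embeds₇′ ψ ⟩
    _                    ≡⟨ total≡1 ⟩
    1                    ∎)
    where open ≡-Reasoning

  x₃-nbrs-in-X₂⁰ : nbrsIn G X₂⁰ x₃ ≡ 1
  x₃-nbrs-in-X₂⁰ = trans (count-cong {p = λ w → X₂⁰ w ∧ adj G x₃ w} {q = X₂⁰∩N₃} (λ _ → refl))
                         (count-by-poly X₂⁰∩N₃ X₂⁰∩N₃-poly (proj₁ ∘ vertex-identity) refl)

  x₁x₃-nbr-in-X₁ : ∃[ w ] (InX G K 1 w × adj G x₁ w ≡ true × adj G x₃ w ≡ true)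
  x₁x₃-nbr-in-X₁ = w , (not-≡-true (proj₁ inX) , eqℕ-sound _ 1 (Equivalence.from T-≡ (proj₂ inX))) , nbrs
    where
    picked = pick X₁∩N₁₃ (count-by-poly X₁∩N₁₃ X₁∩N₁₃-poly (proj₂ ∘ vertex-identity) refl)
    w = proj₁ picked
    level-and-nbrs = ∧-≡-true {not (K w) ∧ eqℕ (nbrsIn G K w) 1} (proj₁ (proj₂ picked))
    inX = ∧-≡-true {not (K w)} (proj₁ level-and-nbrs)
    nbrs = ∧-≡-true {adj G x₁ w} (proj₂ level-and-nbrs)

lemma13 : (G : Graph 95) → IsSRG G 40 12 20 →
    (K : Subset 95) → IsClique G 4 K →
    (∀ (C : Subset 95) → K ⊆ C → ¬ IsClique G 5 C) →
    sizeX G K 0 ≡ 2 → sizeX G K 1 ≡ 31 → sizeX G K 2 ≡ 57 → sizeX G K 3 ≡ 1 →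
    (x₀ x₁ x₃ : Fin 95) → x₀ ≢ x₁ → InX G K 0 x₀ → InX G K 0 x₁ → InX G K 3 x₃ →
    let X₂⁰ : Subset 95
        X₂⁰ = λ v → not (K v) ∧ (eqℕ (nbrsIn G K v) 2 ∧ (adj G x₀ v ∧ not (adj G x₁ v)))
    in ((∃[ w ] (InX G K 1 w × adj G x₁ w ≡ true × adj G x₃ w ≡ true))
          → nbrsIn G X₂⁰ x₃ ≡ 1)
     × (¬ (∃[ w ] (InX G K 1 w × adj G x₁ w ≡ true × adj G x₃ w ≡ true))
          → nbrsIn G X₂⁰ x₃ ≡ 0)
lemma13 G srg K K-clique _ _ _ _ |X₃|≡1 x₀ x₁ x₃ x₀≢x₁ x₀∈X₀ x₁∈X₀ x₃∈X₃ =
  (λ _ → x₃-nbrs-in-X₂⁰) , (λ none → ⊥-elim (none x₁x₃-nbr-in-X₁))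
  where open Configuration srg K-clique x₀≢x₁ x₀∈X₀ x₁∈X₀ x₃∈X₃ |X₃|≡1
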